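{- Let $e$ be an even positive integer, $q=2^e$, $d=(q^2+q+1)/3$, $\sigma(X)=X+X^d+X^{dq}$ (a permutation polynomial of $\mathbb{F}_{q^2}$), and for $\alpha\in\mathbb{F}_q^*$ let $f_\alpha(x)=\operatorname{Tr}_{q^2}(\alpha(\sigma^{ -1}(x))^3)$. For $\beta\in\mathbb{F}_{q^2}$ write $\bar\beta=\beta^q$, and for $z\in\mu_{q+1}$ put $P_\alpha(z)=\alpha(z^9+z^{ -9})$ and $Q_\beta(z)=\beta z^3+\bar\beta z^{ -3}+(\beta+\bar\beta)(z+z^{ -1})$. Then for every $\alpha\in\mathbb{F}_q^*$ and $\beta\in\mathbb{F}_{q^2}$, $$W_{f_\alpha}(\beta)=\sum_{(y,z)\in\mathbb{F}_q\times\mu_{q+1}}(-1)^{\operatorname{Tr}_q(P_\alpha(z)y^3+Q_\beta(z)y)}-q.$$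
   Context: $\mu_{q+1}=\{z\in\mathbb{F}_{q^2}^*:z^{q+1}=1\}$. $\operatorname{Tr}_q,\operatorname{Tr}_{q^2}$ are the absolute traces to $\mathbb{F}_2$ (for $z\in\mu_{q+1}$, $P_\alpha(z)$ and $Q_\beta(z)$ lie in $\mathbb{F}_q$). $W_f(\beta)=\sum_{x\in\mathbb{F}_{q^2}}(-1)^{f(x)+\operatorname{Tr}_{q^2}(\beta x)}$. -}

module Defs where

open import Level using (Level; _⊔_) renaming (suc to lsuc)
open import Algebra.Bundles using (CommutativeRing)
open import Data.Nat as ℕ using (ℕ; zero; suc)
open import Data.Nat.DivMod using (_/_)
open import Data.Integer as ℤ using (ℤ)
open import Data.List using (List; []; _∷_; foldr; filter; map; length; upTo)
open import Data.List.Relation.Unary.Any using (Any)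
open import Data.List.Relation.Unary.AllPairs using (AllPairs)
open import Relation.Nullary using (¬_; yes; no)
open import Relation.Unary using (Pred)
open import Relation.Binary using (Decidable)

record FiniteField (c ℓ : Level) : Set (lsuc (c ⊔ ℓ)) where
  field
    commutativeRing : CommutativeRing c ℓ
  open CommutativeRing commutativeRing public
  field
    _≟_      : Decidable _≈_
    _⁻¹      : Carrier → Carrier
    inverseʳ : ∀ x → ¬ (x ≈ 0#) → (x * (x ⁻¹)) ≈ 1#
    0≉1      : ¬ (0# ≈ 1#)
    elems    : List Carrier
    complete : ∀ x → Any (x ≈_) elems
    distinct : AllPairs (λ a b → ¬ (a ≈ b)) elems

sumℤ : List ℤ → ℤ
sumℤ = foldr ℤ._+_ (ℤ.+ 0)

module _ {c ℓ : Level} (K : FiniteField c ℓ) where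
  open FiniteField K

  pow : Carrier → ℕ → Carrier
  pow x zero    = 1#
  pow x (suc n) = x * pow x n

  sumK : ℕ → (ℕ → Carrier) → Carrier
  sumK zero    g = 0#
  sumK (suc n) g = g n + sumK n g

  Tr : ℕ → Carrier → Carrier
  Tr m x = sumK m (λ i → pow x (2 ℕ.^ i))

  -- (-1)^t for t ∈ F_2 ⊆ K
  sgn : Carrier → ℤ
  sgn t with t ≟ 0#
  ... | yes _ = ℤ.+ 1
  ... | no  _ = ℤ.- (ℤ.+ 1)

  module Paper (e : ℕ) where
    q : ℕ
    q = 2 ℕ.^ e

    q² : ℕ
    q² = q ℕ.* q

    d : ℕ
    d = (q ℕ.* q ℕ.+ q ℕ.+ 1) / 3

    Tr-q² : Carrier → Carrier
    Tr-q² = Tr (2 ℕ.* e)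

    Tr-q : Carrier → Carrier
    Tr-q = Tr e

    σ : Carrier → Carrier
    σ x = x + pow x d + pow x (d ℕ.* q)

    bar : Carrier → Carrier
    bar β = pow β q

    inFq : Carrier → Set ℓ
    inFq y = pow y q ≈ y

    inμ : Carrier → Set ℓ
    inμ z = pow z (q ℕ.+ 1) ≈ 1#

    Fq : List Carrier
    Fq = filter (λ y → pow y q ≟ y) elems

    μ : List Carrier
    μ = filter (λ z → pow z (q ℕ.+ 1) ≟ 1#) elems

    P : Carrier → Carrier → Carrier
    P α z = α * (pow z 9 + pow (z ⁻¹) 9)

    Q : Carrier → Carrier → Carrier
    Q β z = β * pow z 3 + bar β * pow (z ⁻¹) 3 + (β + bar β) * (z + z ⁻¹)

    -- f_α(x) = Tr_{q^2}(α (σ^{-1}(x))^3), with σ^{-1} given as τ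
    f : (Carrier → Carrier) → Carrier → Carrier → Carrier
    f τ α x = Tr-q² (α * pow (τ x) 3)

    W : (Carrier → Carrier) → Carrier → Carrier → ℤ
    W τ α β = sumℤ (map (λ x → sgn (f τ α x + Tr-q² (β * x))) elems)

    RHS : Carrier → Carrier → ℤ
    RHS α β =
      sumℤ (map (λ y → sumℤ (map (λ z →
          sgn (Tr-q (P α z * pow y 3 + Q β z * y))) μ)) Fq)
      ℤ.- ℤ.+ q

-- Substituting x = σ(u) turns W_{f_α}(β) into a sum over u of (-1)^{Tr_{q²}(α u³) + Tr_{q²}(β σ(u))}.
-- Every u ≠ 0 is y z³ with y ∈ F_q^* and z ∈ μ_{q+1}: take y with y^{q+1} = u^{q+1} and z the cube
-- root of u / y, which exists in μ_{q+1} because 3 ∤ q + 1. For such u, u^d = y z and u^{dq} = y z⁻¹,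
-- so σ(u) = y (z³ + z + z⁻¹), and Tr_{q²}(x) = Tr_q(x + x^q) turns the exponent into
-- Tr_q(P_α(z) y³ + Q_β(z) y). Counting, with the root bounds |F_q| ≤ q and |μ_{q+1}| ≤ q + 1, shows that
-- (y, z) ↦ y z³ hits every u ≠ 0 exactly once and that |μ_{q+1}| = q + 1. Finally u = 0 contributes 1
-- to W, and the terms y = 0 contribute q + 1 to the double sum, which accounts for the - q.

{-# OPTIONS --safe #-}
module Submission where

open import Defs
open import Level using (Level)
open import Data.Nat using (ℕ; _<_; _%_)
open import Data.List using (length)
open import Relation.Nullary using (¬_)
open import Relation.Binary.PropositionalEquality using (_≡_)

open import Data.Nat as ℕ using (zero; suc; _≤_; z≤n; s≤s; z<s)
import Data.Nat.Properties as ℕP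
open import Data.Nat.Properties using (m≤m+n; m<m+n; ≤-trans; ≤-reflexive; <⇒≱)
open import Data.Integer as ℤ using (ℤ)
import Data.Integer.Properties as ℤP
open import Data.List using (List; []; _∷_; _++_; map; filter; foldr; replicate; cartesianProduct)
open import Data.List.Properties
  using ( length-++; length-map; length-replicate; filter-all; filter-reject; ++-identityʳ
        ; map-++; map-∘; map-cong; map-cong-local)
open import Data.List.Relation.Unary.Any using (here; there)
open import Data.List.Relation.Unary.All as All using (All; []; _∷_)
import Data.List.Relation.Unary.All.Properties as AllP
open import Data.List.Relation.Unary.AllPairs using ([]; _∷_)
open import Data.Product using (_×_; _,_; ∃-syntax; proj₂; uncurry)
open import Data.Product.Relation.Binary.Pointwise.NonDependent using (Pointwise; _×ₛ_)
open import Function using (_∘_)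
open import Relation.Binary.Bundles using (Setoid)
open import Relation.Binary.Definitions using (Decidable)
import Relation.Binary.PropositionalEquality as ≡
open import Relation.Nullary using (¬?; yes; no; contradiction)
import Relation.Binary.Properties.Setoid as SetoidProperties
import Data.List.Membership.Setoid as Membership
import Data.List.Membership.Setoid.Properties as MembershipP
import Data.List.Relation.Binary.Subset.Setoid as Subset
import Data.List.Relation.Binary.Permutation.Setoid as Permutation
import Data.List.Relation.Binary.Permutation.Setoid.Properties as PermutationP
import Data.List.Relation.Unary.Unique.Setoid as UniqueS
import Data.List.Relation.Unary.Unique.Setoid.Properties as UniqueP
import Algebra.Properties.CommutativeSemiring.Exp as Exp
import Algebra.Properties.Ring as RingProperties
import Algebra.Properties.Group as GroupProperties

module UniqueLists {a ℓ} (S : Setoid a ℓ) where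
  open Setoid S renaming (Carrier to A)
  open Membership S using (_∈_)
  open Subset S using (_⊆_)
  open Permutation S
    using (_↭_; module PermutationReasoning; ↭-refl; ↭-trans; ↭-prep; ↭-sym; ↭-reflexive; ↭-reflexive-≋)
  open PermutationP S using (shift; ∈-resp-↭; xs↭ys⇒|xs|≡|ys|; Unique-resp-↭)
  open UniqueS S using (Unique)
  open SetoidProperties S using (≉-resp₂)

  ∈⇒↭∷ : ∀ {x xs} → x ∈ xs → ∃[ ys ] xs ↭ x ∷ ys
  ∈⇒↭∷ x∈xs with MembershipP.∈-∃++ S x∈xs
  ... | ys , zs , w , x≈w , xs≋ = ys ++ zs , ↭-trans (↭-reflexive-≋ xs≋) (shift (sym x≈w) ys zs)

  Unique∧⊆⇒↭++ : ∀ {xs ys} → Unique xs → xs ⊆ ys → ∃[ zs ] ys ↭ xs ++ zs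
  Unique∧⊆⇒↭++ {[]} {ys} _ _ = ys , ↭-refl
  Unique∧⊆⇒↭++ {x ∷ xs} xs! xs⊆ys with ∈⇒↭∷ (xs⊆ys (here refl))
  ... | ys′ , ys↭ with Unique∧⊆⇒↭++ (UniqueS.tail S xs!) xs⊆ys′
    where
    xs⊆ys′ : xs ⊆ ys′
    xs⊆ys′ v∈xs with ∈-resp-↭ ys↭ (xs⊆ys (there v∈xs))
    ... | here v≈x    = contradiction (MembershipP.∈-resp-≈ S v≈x v∈xs) (UniqueP.Unique[x∷xs]⇒x∉xs S xs!)
    ... | there v∈ys′ = v∈ys′
  ... | zs , ys′↭ = zs , ↭-trans ys↭ (↭-prep x ys′↭)

  private
    ↭++⇒|ys|≡|xs|+|zs| : ∀ xs {ys zs} → ys ↭ xs ++ zs → length ys ≡ length xs ℕ.+ length zs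
    ↭++⇒|ys|≡|xs|+|zs| xs ys↭ = ≡.trans (xs↭ys⇒|xs|≡|ys| ys↭) (length-++ xs)

  Unique∧⊆⇒|xs|≤|ys| : ∀ {xs ys} → Unique xs → xs ⊆ ys → length xs ≤ length ys
  Unique∧⊆⇒|xs|≤|ys| {xs} xs! xs⊆ys with zs , ys↭ ← Unique∧⊆⇒↭++ xs! xs⊆ys =
    ≤-trans (m≤m+n (length xs) (length zs)) (≤-reflexive (≡.sym (↭++⇒|ys|≡|xs|+|zs| xs ys↭)))

  Unique∧⊆∧|ys|≤|xs|⇒↭ : ∀ {xs ys} → Unique xs → xs ⊆ ys → length ys ≤ length xs → xs ↭ ys
  Unique∧⊆∧|ys|≤|xs|⇒↭ {xs} xs! xs⊆ys |ys|≤|xs| with Unique∧⊆⇒↭++ xs! xs⊆ys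
  ... | [] , ys↭ = ↭-sym (↭-trans ys↭ (↭-reflexive (++-identityʳ xs)))
  ... | _ ∷ zs , ys↭ = contradiction |ys|≤|xs|
    (<⇒≱ (≤-trans (m<m+n (length xs) z<s) (≤-reflexive (≡.sym (↭++⇒|ys|≡|xs|+|zs| xs ys↭)))))

  map-section-↭ : ∀ {f g : A → A} {xs} → (∀ {x y} → x ≈ y → g x ≈ g y) → (∀ x → g (f x) ≈ x) →
                  Unique xs → (∀ x → x ∈ xs) → map f xs ↭ xs
  map-section-↭ {f} {g} {xs} g-cong g∘f≈id xs! complete = Unique∧⊆∧|ys|≤|xs|⇒↭
    (UniqueP.map⁺ S S (λ {x} {y} fx≈fy → trans (sym (g∘f≈id x)) (trans (g-cong fx≈fy) (g∘f≈id y))) xs!)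
    (λ {x} _ → complete x)
    (≤-reflexive (≡.sym (length-map f xs)))

  module _ (_≟_ : Decidable _≈_) where

    Unique∧∈⇒↭∷filter≉ : ∀ {x xs} → Unique xs → x ∈ xs → xs ↭ x ∷ filter (λ y → ¬? (y ≟ x)) xs
    Unique∧∈⇒↭∷filter≉ {x} {xs} xs! x∈xs with ys , xs↭ ← ∈⇒↭∷ x∈xs = begin
      xs                  ↭⟨ xs↭ ⟩
      x ∷ ys              ≡⟨ ≡.cong (x ∷_) (≡.sym (filter-all ≉x? ys≉x)) ⟩
      x ∷ filter ≉x? ys   ≡⟨ ≡.cong (x ∷_) (≡.sym (filter-reject ≉x? (λ x≉x → x≉x refl))) ⟩
      x ∷ filter ≉x? (x ∷ ys) ↭⟨ ↭-prep x (PermutationP.filter⁺ S ≉x? (proj₂ ≉-resp₂) (↭-sym xs↭)) ⟩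
      x ∷ filter ≉x? xs   ∎
      where
      open PermutationReasoning
      ≉x? = λ y → ¬? (y ≟ x)
      ys≉x : All (λ y → ¬ y ≈ x) ys
      ys≉x = All.map (λ x≉y y≈x → x≉y (sym y≈x)) (UniqueS.head S (Unique-resp-↭ xs↭ xs!))

module _ {a ℓ} (S : Setoid a ℓ) where
  open Setoid S renaming (Carrier to A)
  open Permutation S using (_↭_)

  sumℤ-map-↭ : ∀ {h : A → ℤ} → (∀ {x y} → x ≈ y → h x ≡ h y) →
               ∀ {xs ys} → xs ↭ ys → sumℤ (map h xs) ≡ sumℤ (map h ys)
  sumℤ-map-↭ h-cong xs↭ys = PermutationP.foldr-commMonoid (≡.setoid ℤ) ℤP.+-0-isCommutativeMonoid
    (PermutationP.map⁺ S (≡.setoid ℤ) h-cong xs↭ys)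

sumℤ-++ : ∀ xs ys → sumℤ (xs ++ ys) ≡ sumℤ xs ℤ.+ sumℤ ys
sumℤ-++ []       ys = ≡.sym (ℤP.+-identityˡ (sumℤ ys))
sumℤ-++ (x ∷ xs) ys =
  ≡.trans (≡.cong (ℤ._+_ x) (sumℤ-++ xs ys)) (≡.sym (ℤP.+-assoc x (sumℤ xs) (sumℤ ys)))

sumℤ-cartesianProduct : ∀ {a b} {A : Set a} {B : Set b} (h : A → B → ℤ) xs ys →
  sumℤ (map (uncurry h) (cartesianProduct xs ys)) ≡ sumℤ (map (λ x → sumℤ (map (h x) ys)) xs)
sumℤ-cartesianProduct h []       ys = ≡.refl
sumℤ-cartesianProduct h (x ∷ xs) ys = begin
  sumℤ (map (uncurry h) (map (x ,_) ys ++ cartesianProduct xs ys))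
    ≡⟨ ≡.cong sumℤ (map-++ (uncurry h) (map (x ,_) ys) _) ⟩
  sumℤ (map (uncurry h) (map (x ,_) ys) ++ map (uncurry h) (cartesianProduct xs ys))
    ≡⟨ sumℤ-++ (map (uncurry h) (map (x ,_) ys)) _ ⟩
  sumℤ (map (uncurry h) (map (x ,_) ys)) ℤ.+ sumℤ (map (uncurry h) (cartesianProduct xs ys))
    ≡⟨ ≡.cong₂ ℤ._+_ (≡.cong sumℤ (≡.sym (map-∘ ys))) (sumℤ-cartesianProduct h xs ys) ⟩
  sumℤ (map (h x) ys) ℤ.+ sumℤ (map (λ x → sumℤ (map (h x) ys)) xs) ∎
  where open ≡.≡-Reasoning

sumℤ-map-1 : ∀ {a} {A : Set a} {h : A → ℤ} → (∀ x → h x ≡ ℤ.+ 1) →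
             ∀ xs → sumℤ (map h xs) ≡ ℤ.+ length xs
sumℤ-map-1 h≡1 []       = ≡.refl
sumℤ-map-1 h≡1 (x ∷ xs) = ≡.cong₂ ℤ._+_ (h≡1 x) (sumℤ-map-1 h≡1 xs)

length-cartesianProduct : ∀ {a b} {A : Set a} {B : Set b} (xs : List A) (ys : List B) →
                          length (cartesianProduct xs ys) ≡ length xs ℕ.* length ys
length-cartesianProduct []       ys = ≡.refl
length-cartesianProduct (x ∷ xs) ys = begin
  length (map (x ,_) ys ++ cartesianProduct xs ys)
    ≡⟨ length-++ (map (x ,_) ys) ⟩
  length (map (x ,_) ys) ℕ.+ length (cartesianProduct xs ys)
    ≡⟨ ≡.cong₂ ℕ._+_ (length-map (x ,_) ys) (length-cartesianProduct xs ys) ⟩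
  length ys ℕ.+ length xs ℕ.* length ys ∎
  where open ≡.≡-Reasoning

module Arithmetic where
  open import Data.Nat
  open import Data.Nat.Properties
  open import Data.Nat.DivMod using (_/_; _%_; m≡m%n+[m/n]*n; m*n/n≡m)
  open import Data.Nat.Tactic.RingSolver using (solve-∀)
  open import Data.Integer.Properties using (pos-+)
  import Data.Integer.Tactic.RingSolver as ℤSolver
  open import Data.Sum using (inj₁; inj₂)
  open import Relation.Binary.PropositionalEquality

  private
    4[1+3k]≡1+3[4k+1] : ∀ k → 4 * suc (3 * k) ≡ suc (3 * (4 * k + 1))
    4[1+3k]≡1+3[4k+1] = solve-∀

    [1+3k]²+[1+3k]+1≡[1+[1+k]3k]*3 : ∀ k →
      suc (3 * k) * suc (3 * k) + suc (3 * k) + 1 ≡ suc (suc k * (3 * k)) * 3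
    [1+3k]²+[1+3k]+1≡[1+[1+k]3k]*3 = solve-∀

    3[1+[1+k]3k]≡[1+3k]²+[1+3k]+1 : ∀ k →
      3 * suc (suc k * (3 * k)) ≡ suc (3 * k) * suc (3 * k) + (suc (3 * k) + 1)
    3[1+[1+k]3k]≡[1+3k]²+[1+3k]+1 = solve-∀

    3[1+k]≡[1+3k]+1+1 : ∀ k → 3 * suc k ≡ (suc (3 * k) + 1) + 1
    3[1+k]≡[1+3k]+1+1 = solve-∀

    1+p[2+p]≡[1+p]² : ∀ p → suc (p * suc (suc p)) ≡ suc p * suc p
    1+p[2+p]≡[1+p]² = solve-∀

  2^[2t]≡1+3k : ∀ t → ∃[ k ] 2 ^ (t * 2) ≡ suc (3 * k)
  2^[2t]≡1+3k zero = 0 , refl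
  2^[2t]≡1+3k (suc t) with k , 2^[2t]≡ ← 2^[2t]≡1+3k t = 4 * k + 1 , (begin
    2 ^ (2 + t * 2)       ≡⟨ ^-distribˡ-+-* 2 2 (t * 2) ⟩
    4 * 2 ^ (t * 2)       ≡⟨ cong (4 *_) 2^[2t]≡ ⟩
    4 * suc (3 * k)       ≡⟨ 4[1+3k]≡1+3[4k+1] k ⟩
    suc (3 * (4 * k + 1)) ∎)
    where open ≡-Reasoning

  2^even≡1+3k : ∀ e → e % 2 ≡ 0 → ∃[ k ] 2 ^ e ≡ suc (3 * k)
  2^even≡1+3k e e%2≡0 with k , 2^[2t]≡ ← 2^[2t]≡1+3k (e / 2) = k , trans (cong (2 ^_) e≡[e/2]*2) 2^[2t]≡
    where
    e≡[e/2]*2 : e ≡ e / 2 * 2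
    e≡[e/2]*2 = trans (m≡m%n+[m/n]*n e 2) (cong (_+ e / 2 * 2) e%2≡0)

  module CubeExponents (q k : ℕ) (q≡1+3k : q ≡ suc (3 * k)) where

    d≡1+[1+k]*3k : (q * q + q + 1) / 3 ≡ suc (suc k * (3 * k))
    d≡1+[1+k]*3k = trans (cong (λ q → (q * q + q + 1) / 3) q≡1+3k)
      (trans (cong (_/ 3) ([1+3k]²+[1+3k]+1≡[1+[1+k]3k]*3 k)) (m*n/n≡m (suc (suc k * (3 * k))) 3))

    3d≡q²+q+1 : 3 * ((q * q + q + 1) / 3) ≡ q * q + (q + 1)
    3d≡q²+q+1 rewrite d≡1+[1+k]*3k | q≡1+3k = 3[1+[1+k]3k]≡[1+3k]²+[1+3k]+1 k

    3[1+k]≡q+2 : 3 * suc k ≡ (q + 1) + 1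
    3[1+k]≡q+2 rewrite q≡1+3k = 3[1+k]≡[1+3k]+1+1 k

  1+ab≤q² : ∀ {a b q} → suc a ≤ q → b ≤ suc q → suc (a * b) ≤ q * q
  1+ab≤q² {a} {b} {suc p} (s≤s a≤p) b≤2+p = begin
    suc (a * b)               ≤⟨ s≤s (*-mono-≤ a≤p b≤2+p) ⟩
    suc (p * suc (suc p))     ≡⟨ 1+p[2+p]≡[1+p]² p ⟩
    suc p * suc p             ∎
    where open ≤-Reasoning

  q²≤1+ab⇒b≡1+q : ∀ {a b q} → 2 ≤ q → suc a ≤ q → b ≤ suc q → q * q ≤ suc (a * b) → b ≡ suc q
  q²≤1+ab⇒b≡1+q {a} {b} {suc p} 2≤q (s≤s a≤p) b≤1+q q²≤1+ab with m≤n⇒m<n∨m≡n b≤1+q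
  ... | inj₂ b≡1+q     = b≡1+q
  ... | inj₁ (s≤s b≤q) = contradiction q²≤1+ab (<⇒≱ (begin-strict
    suc (a * b)       ≤⟨ s≤s (*-mono-≤ a≤p b≤q) ⟩
    suc (p * suc p)   <⟨ +-monoˡ-< (p * suc p) 2≤q ⟩
    suc p + p * suc p ∎))
    where open ≤-Reasoning

  [1+n+x]-n≡1+x : ∀ n x → (ℤ.+ suc n ℤ.+ x) ℤ.- ℤ.+ n ≡ ℤ.+ 1 ℤ.+ x
  [1+n+x]-n≡1+x n x = trans (cong (λ t → (t ℤ.+ x) ℤ.- ℤ.+ n) (pos-+ 1 n)) (1+m+x-m≡1+x (ℤ.+ n) x)
    where
    1+m+x-m≡1+x : ∀ m x → ((ℤ.+ 1 ℤ.+ m) ℤ.+ x) ℤ.- m ≡ ℤ.+ 1 ℤ.+ x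
    1+m+x-m≡1+x = ℤSolver.solve-∀

module FieldFacts {c ℓ : Level} (K : FiniteField c ℓ) where
  open FiniteField K
  open Exp commutativeSemiring using (_^_; ^-congˡ; ^-homo-*; ^-assocʳ; ^-distrib-*)
  open import Relation.Binary.Reasoning.Setoid setoid
  open import Algebra.Solver.Ring.NaturalCoefficients.Default commutativeSemiring
  open UniqueLists setoid
  open Permutation setoid using (_↭_)
  open PermutationP setoid using (foldr-commMonoid; xs↭ys⇒|xs|≡|ys|)
  open UniqueS setoid using (Unique)
  open Membership setoid using (_∈_)
  open SetoidProperties setoid using (≉-resp₂)

  sgn-cong : ∀ {s t} → s ≈ t → sgn K s ≡ sgn K t
  sgn-cong {s} {t} s≈t with s ≟ 0# | t ≟ 0#
  ... | yes _   | yes _   = ≡.refl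
  ... | no  _   | no  _   = ≡.refl
  ... | yes s≈0 | no  t≉0 = contradiction (trans (sym s≈t) s≈0) t≉0
  ... | no  s≉0 | yes t≈0 = contradiction (trans s≈t t≈0) s≉0

  sgn-≈0 : ∀ {t} → t ≈ 0# → sgn K t ≡ ℤ.+ 1
  sgn-≈0 {t} t≈0 with t ≟ 0#
  ... | yes _   = ≡.refl
  ... | no  t≉0 = contradiction t≈0 t≉0

  pow≡^ : ∀ x n → pow K x n ≡ x ^ n
  pow≡^ x zero    = ≡.refl
  pow≡^ x (suc n) = ≡.cong (x *_) (pow≡^ x n)

  pow-congˡ : ∀ n {x y} → x ≈ y → pow K x n ≈ pow K y n
  pow-congˡ n {x} {y} rewrite pow≡^ x n | pow≡^ y n = ^-congˡ n

  pow-congʳ : ∀ x {m n} → m ≡ n → pow K x m ≈ pow K x n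
  pow-congʳ x ≡.refl = refl

  pow-homo-* : ∀ x m n → pow K x (m ℕ.+ n) ≈ pow K x m * pow K x n
  pow-homo-* x m n rewrite pow≡^ x (m ℕ.+ n) | pow≡^ x m | pow≡^ x n = ^-homo-* x m n

  pow-assocʳ : ∀ x m n → pow K (pow K x m) n ≈ pow K x (m ℕ.* n)
  pow-assocʳ x m n rewrite pow≡^ (pow K x m) n | pow≡^ x m | pow≡^ x (m ℕ.* n) = ^-assocʳ x m n

  pow-distrib-* : ∀ x y n → pow K (x * y) n ≈ pow K x n * pow K y n
  pow-distrib-* x y n rewrite pow≡^ (x * y) n | pow≡^ x n | pow≡^ y n = ^-distrib-* x y n

  pow-comm : ∀ x m n → pow K (pow K x m) n ≈ pow K (pow K x n) m
  pow-comm x m n = begin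
    pow K (pow K x m) n ≈⟨ pow-assocʳ x m n ⟩
    pow K x (m ℕ.* n)   ≈⟨ pow-congʳ x (ℕP.*-comm m n) ⟩
    pow K x (n ℕ.* m)   ≈⟨ pow-assocʳ x n m ⟨
    pow K (pow K x n) m ∎

  pow-1# : ∀ n → pow K 1# n ≈ 1#
  pow-1# zero    = refl
  pow-1# (suc n) = trans (*-identityˡ _) (pow-1# n)

  pow-0# : ∀ n → pow K 0# (suc n) ≈ 0#
  pow-0# n = zeroˡ _

  x*x⁻¹*y≈y : ∀ {x} y → ¬ x ≈ 0# → x * (x ⁻¹ * y) ≈ y
  x*x⁻¹*y≈y {x} y x≉0 = begin
    x * (x ⁻¹ * y) ≈⟨ *-assoc x (x ⁻¹) y ⟨
    x * x ⁻¹ * y   ≈⟨ *-congʳ (inverseʳ x x≉0) ⟩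
    1# * y         ≈⟨ *-identityˡ y ⟩
    y              ∎

  *-cancelˡ : ∀ {x y z} → ¬ x ≈ 0# → x * y ≈ x * z → y ≈ z
  *-cancelˡ {x} {y} {z} x≉0 xy≈xz = begin
    y              ≈⟨ x*x⁻¹*y≈y y x≉0 ⟨
    x * (x ⁻¹ * y) ≈⟨ *-congˡ (*-comm (x ⁻¹) y) ⟩
    x * (y * x ⁻¹) ≈⟨ *-assoc x y (x ⁻¹) ⟨
    x * y * x ⁻¹   ≈⟨ *-congʳ xy≈xz ⟩
    x * z * x ⁻¹   ≈⟨ *-assoc x z (x ⁻¹) ⟩
    x * (z * x ⁻¹) ≈⟨ *-congˡ (*-comm z (x ⁻¹)) ⟩
    x * (x ⁻¹ * z) ≈⟨ x*x⁻¹*y≈y z x≉0 ⟩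
    z              ∎

  x*y≈0⇒y≈0 : ∀ {x y} → ¬ x ≈ 0# → x * y ≈ 0# → y ≈ 0#
  x*y≈0⇒y≈0 {x} x≉0 xy≈0 = *-cancelˡ x≉0 (trans xy≈0 (sym (zeroʳ x)))

  x*y≉0 : ∀ {x y} → ¬ x ≈ 0# → ¬ y ≈ 0# → ¬ x * y ≈ 0#
  x*y≉0 x≉0 y≉0 xy≈0 = y≉0 (x*y≈0⇒y≈0 x≉0 xy≈0)

  pow≉0 : ∀ {x} n → ¬ x ≈ 0# → ¬ pow K x n ≈ 0#
  pow≉0 zero    x≉0 1≈0 = 0≉1 (sym 1≈0)
  pow≉0 (suc n) x≉0     = x*y≉0 x≉0 (pow≉0 n x≉0)

  x*y≈1⇒y≈x⁻¹ : ∀ {x y} → x * y ≈ 1# → y ≈ x ⁻¹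
  x*y≈1⇒y≈x⁻¹ {x} {y} xy≈1 = *-cancelˡ x≉0 (trans xy≈1 (sym (inverseʳ x x≉0)))
    where
    x≉0 : ¬ x ≈ 0#
    x≉0 x≈0 = 0≉1 (trans (sym (trans (*-congʳ x≈0) (zeroˡ y))) xy≈1)

  x*z≈y*z⇒z≈0 : ∀ {x y z} → ¬ x ≈ y → x * z ≈ y * z → z ≈ 0#
  x*z≈y*z⇒z≈0 {x} {y} {z} x≉y xz≈yz = x*y≈0⇒y≈0 x-y≉0 (begin
    (x - y) * z     ≈⟨ [y-z]x≈yx-zx z x y ⟩
    x * z - y * z   ≈⟨ x≈y⇒x-y≈0 xz≈yz ⟩
    0#              ∎)
    where
    open RingProperties ring using ([y-z]x≈yx-zx)
    open GroupProperties +-group using ()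
      renaming (x≈y⇒x∙y⁻¹≈ε to x≈y⇒x-y≈0; x∙y⁻¹≈ε⇒x≈y to x-y≈0⇒x≈y)
    x-y≉0 : ¬ x - y ≈ 0#
    x-y≉0 x-y≈0 = x≉y (x-y≈0⇒x≈y x y x-y≈0)

  -- monic (c₀ ∷ … ∷ cₙ₋₁) is xⁿ + cₙ₋₁ xⁿ⁻¹ + … + c₀, evaluated by Horner's rule.
  monic : List Carrier → Carrier → Carrier
  monic []       x = 1#
  monic (c ∷ cs) x = c + x * monic cs x

  deflate : Carrier → List Carrier → List Carrier
  deflate r []                = []
  deflate r (_ ∷ [])          = []
  deflate r (_ ∷ cs@(_ ∷ _)) = monic cs r ∷ deflate r cs

  length-deflate : ∀ r c cs → length (deflate r (c ∷ cs)) ≡ length cs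
  length-deflate r c []       = ≡.refl
  length-deflate r c (d ∷ cs) = ≡.cong suc (length-deflate r d cs)

  -- p(x) - p(r) = (x - r) (deflate r p)(x), with both sides moved so that no subtraction occurs
  monic-deflate : ∀ r c cs x →
    monic (c ∷ cs) x + r * monic (deflate r (c ∷ cs)) x ≈ monic (c ∷ cs) r + x * monic (deflate r (c ∷ cs)) x
  monic-deflate r c [] x =
    solve 3 (λ c r x → (c :+ x :* con 1) :+ r :* con 1 := (c :+ r :* con 1) :+ x :* con 1) refl c r x
  monic-deflate r c (d ∷ cs) x = begin
    (c + x * p x) + r * (p r + x * q x) ≈⟨ solve 6 (λ c x r px pr qx →
                                            (c :+ x :* px) :+ r :* (pr :+ x :* qx) := (c :+ r :* pr) :+ x :* (px :+ r :* qx))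
                                          refl c x r (p x) (p r) (q x) ⟩
    (c + r * p r) + x * (p x + r * q x) ≈⟨ +-congˡ (*-congˡ (monic-deflate r d cs x)) ⟩
    (c + r * p r) + x * (p r + x * q x) ∎
    where
    p = monic (d ∷ cs)
    q = monic (deflate r (d ∷ cs))

  deflate-root : ∀ {r s} c cs → ¬ r ≈ s → monic (c ∷ cs) r ≈ 0# → monic (c ∷ cs) s ≈ 0# →
                 monic (deflate r (c ∷ cs)) s ≈ 0#
  deflate-root {r} {s} c cs r≉s pr≈0 ps≈0 = x*z≈y*z⇒z≈0 r≉s (begin
    r * q              ≈⟨ +-identityˡ _ ⟨
    0# + r * q         ≈⟨ +-congʳ ps≈0 ⟨
    monic (c ∷ cs) s + r * q ≈⟨ monic-deflate r c cs s ⟩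
    monic (c ∷ cs) r + s * q ≈⟨ +-congʳ pr≈0 ⟩
    0# + s * q         ≈⟨ +-identityˡ _ ⟩
    s * q              ∎)
    where q = monic (deflate r (c ∷ cs)) s

  monic-roots-bound : ∀ cs {rs} → Unique rs → All (λ r → monic cs r ≈ 0#) rs → length rs ≤ length cs
  monic-roots-bound cs       {[]}     _           _           = z≤n
  monic-roots-bound []       {_ ∷ _}  _           (1≈0 ∷ _)   = contradiction (sym 1≈0) 0≉1
  monic-roots-bound (c ∷ cs) {r ∷ rs} (r≉rs ∷ rs!) (pr≈0 ∷ prs≈0) =
    s≤s (≡.subst (length rs ≤_) (length-deflate r c cs)
          (monic-roots-bound (deflate r (c ∷ cs)) rs!
            (All.zipWith (λ (r≉s , ps≈0) → deflate-root c cs r≉s pr≈0 ps≈0) (r≉rs , prs≈0))))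

  nonzeros : List Carrier
  nonzeros = filter (λ x → ¬? (x ≟ 0#)) elems

  elems↭0∷nonzeros : elems ↭ 0# ∷ nonzeros
  elems↭0∷nonzeros = Unique∧∈⇒↭∷filter≉ _≟_ distinct (complete 0#)

  nonzeros-complete : ∀ {x} → ¬ x ≈ 0# → x ∈ nonzeros
  nonzeros-complete x≉0 = MembershipP.∈-filter⁺ setoid (λ x → ¬? (x ≟ 0#)) (proj₂ ≉-resp₂) (complete _) x≉0

  nonzeros-≉0 : ∀ {x} → x ∈ nonzeros → ¬ x ≈ 0#
  nonzeros-≉0 x∈ = proj₂ (MembershipP.∈-filter⁻ setoid (λ x → ¬? (x ≟ 0#)) (proj₂ ≉-resp₂) {xs = elems} x∈)

  private
    prod : List Carrier → Carrier
    prod = foldr _*_ 1#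

    prod-map-* : ∀ a xs → prod (map (a *_) xs) ≈ pow K a (length xs) * prod xs
    prod-map-* a []       = sym (*-identityʳ 1#)
    prod-map-* a (x ∷ xs) = begin
      a * x * prod (map (a *_) xs)        ≈⟨ *-congˡ (prod-map-* a xs) ⟩
      a * x * (pow K a (length xs) * prod xs) ≈⟨ solve 4 (λ a x p r → a :* x :* (p :* r) := a :* p :* (x :* r))
                                                  refl a x (pow K a (length xs)) (prod xs) ⟩
      a * pow K a (length xs) * (x * prod xs) ∎

    prod-≉0 : ∀ {xs} → All (λ x → ¬ x ≈ 0#) xs → ¬ prod xs ≈ 0#
    prod-≉0 []           1≈0 = 0≉1 (sym 1≈0)
    prod-≉0 (x≉0 ∷ xs≉0)     = x*y≉0 x≉0 (prod-≉0 xs≉0)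

  a*nonzeros↭nonzeros : ∀ {a} → ¬ a ≈ 0# → map (a *_) nonzeros ↭ nonzeros
  a*nonzeros↭nonzeros {a} a≉0 =
    Unique∧⊆∧|ys|≤|xs|⇒↭
      (UniqueP.map⁺ setoid setoid (*-cancelˡ a≉0) (UniqueP.filter⁺ setoid _ distinct))
      ax∈nonzeros
      (≤-reflexive (≡.sym (length-map (a *_) nonzeros)))
    where
    ax∈nonzeros : ∀ {y} → y ∈ map (a *_) nonzeros → y ∈ nonzeros
    ax∈nonzeros y∈ with x , x∈ , y≈ax ← MembershipP.∈-map⁻ setoid setoid y∈ =
      nonzeros-complete (λ y≈0 → x*y≉0 a≉0 (nonzeros-≉0 x∈) (trans (sym y≈ax) y≈0))

  pow-|nonzeros| : ∀ {a} → ¬ a ≈ 0# → pow K a (length nonzeros) ≈ 1#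
  pow-|nonzeros| {a} a≉0 = *-cancelˡ (prod-≉0 (All.tabulateₛ setoid nonzeros-≉0)) (begin
    prod nonzeros * pow K a (length nonzeros) ≈⟨ *-comm _ _ ⟩
    pow K a (length nonzeros) * prod nonzeros ≈⟨ prod-map-* a nonzeros ⟨
    prod (map (a *_) nonzeros)               ≈⟨ foldr-commMonoid *-isCommutativeMonoid (a*nonzeros↭nonzeros a≉0) ⟩
    prod nonzeros                            ≈⟨ *-identityʳ _ ⟨
    prod nonzeros * 1#                       ∎)

  pow-|elems| : ∀ x → pow K x (length elems) ≈ x
  pow-|elems| x rewrite xs↭ys⇒|xs|≡|ys| elems↭0∷nonzeros with x ≟ 0#
  ... | yes x≈0 = trans (*-congʳ x≈0) (trans (zeroˡ _) (sym x≈0))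
  ... | no  x≉0 = trans (*-congˡ (pow-|nonzeros| x≉0)) (*-identityʳ x)

  sumK-cong : ∀ n {g h} → (∀ i → g i ≈ h i) → sumK K n g ≈ sumK K n h
  sumK-cong zero    g≈h = refl
  sumK-cong (suc n) g≈h = +-cong (g≈h n) (sumK-cong n g≈h)

  sumK-distrib-+ : ∀ n g h → sumK K n (λ i → g i + h i) ≈ sumK K n g + sumK K n h
  sumK-distrib-+ zero    g h = sym (+-identityˡ 0#)
  sumK-distrib-+ (suc n) g h = begin
    (g n + h n) + sumK K n (λ i → g i + h i) ≈⟨ +-congˡ (sumK-distrib-+ n g h) ⟩
    (g n + h n) + (sumK K n g + sumK K n h) ≈⟨ solve 4 (λ a b c d → (a :+ b) :+ (c :+ d) := (a :+ c) :+ (b :+ d))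
                                                 refl (g n) (h n) (sumK K n g) (sumK K n h) ⟩
    (g n + sumK K n g) + (h n + sumK K n h) ∎

  sumK-split : ∀ m n g → sumK K (m ℕ.+ n) g ≈ sumK K m (λ i → g (i ℕ.+ n)) + sumK K n g
  sumK-split zero    n g = sym (+-identityˡ _)
  sumK-split (suc m) n g = trans (+-congˡ (sumK-split m n g)) (sym (+-assoc _ _ _))

  module Characteristic2 (1+1≈0 : 1# + 1# ≈ 0#) where

    x+x≈0 : ∀ x → x + x ≈ 0#
    x+x≈0 x = begin
      x + x             ≈⟨ +-cong (*-identityˡ x) (*-identityˡ x) ⟨
      1# * x + 1# * x   ≈⟨ distribʳ x 1# 1# ⟨
      (1# + 1#) * x     ≈⟨ *-congʳ 1+1≈0 ⟩
      0# * x            ≈⟨ zeroˡ x ⟩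
      0#                ∎

    frobenius : ∀ i x y → pow K (x + y) (2 ℕ.^ i) ≈ pow K x (2 ℕ.^ i) + pow K y (2 ℕ.^ i)
    frobenius zero    x y = solve 2 (λ x y → (x :+ y) :* con 1 := x :* con 1 :+ y :* con 1) refl x y
    frobenius (suc i) x y = begin
      pow K (x + y) (2 ℕ.* 2 ℕ.^ i)            ≈⟨ pow-assocʳ (x + y) 2 (2 ℕ.^ i) ⟨
      pow K (pow K (x + y) 2) (2 ℕ.^ i)        ≈⟨ pow-congˡ (2 ℕ.^ i) square-+ ⟩
      pow K (pow K x 2 + pow K y 2) (2 ℕ.^ i)  ≈⟨ frobenius i (pow K x 2) (pow K y 2) ⟩
      pow K (pow K x 2) (2 ℕ.^ i) + pow K (pow K y 2) (2 ℕ.^ i)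
                                               ≈⟨ +-cong (pow-assocʳ x 2 (2 ℕ.^ i)) (pow-assocʳ y 2 (2 ℕ.^ i)) ⟩
      pow K x (2 ℕ.* 2 ℕ.^ i) + pow K y (2 ℕ.* 2 ℕ.^ i) ∎
      where
      square-+ : pow K (x + y) 2 ≈ pow K x 2 + pow K y 2
      square-+ = begin
        pow K (x + y) 2                             ≈⟨ solve 2 (λ x y → (x :+ y) :^ 2 := (x :^ 2 :+ y :^ 2) :+ (x :* y :+ x :* y))
                                                         refl x y ⟩
        (pow K x 2 + pow K y 2) + (x * y + x * y)   ≈⟨ +-congˡ (x+x≈0 (x * y)) ⟩
        (pow K x 2 + pow K y 2) + 0#                ≈⟨ +-identityʳ _ ⟩
        pow K x 2 + pow K y 2                       ∎

    Tr-cong : ∀ m {x y} → x ≈ y → Tr K m x ≈ Tr K m y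
    Tr-cong m x≈y = sumK-cong m (λ i → pow-congˡ (2 ℕ.^ i) x≈y)

    Tr-+ : ∀ m x y → Tr K m (x + y) ≈ Tr K m x + Tr K m y
    Tr-+ m x y = trans (sumK-cong m (λ i → frobenius i x y)) (sumK-distrib-+ m _ _)

    Tr-0# : ∀ m → Tr K m 0# ≈ 0#
    Tr-0# m = x+x≈x⇒x≈0 (Tr K m 0#) (trans (sym (Tr-+ m 0# 0#)) (Tr-cong m (+-identityʳ 0#)))
      where open RingProperties ring using (x+x≈x⇒x≈0)

    Tr-split : ∀ m n x → Tr K (m ℕ.+ n) x ≈ Tr K m (pow K x (2 ℕ.^ n)) + Tr K n x
    Tr-split m n x = trans (sumK-split m n _) (+-congʳ (sumK-cong m shift))
      where
      shift : ∀ i → pow K x (2 ℕ.^ (i ℕ.+ n)) ≈ pow K (pow K x (2 ℕ.^ n)) (2 ℕ.^ i)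
      shift i = trans (pow-congʳ x (≡.trans (ℕP.^-distribˡ-+-* 2 i n) (ℕP.*-comm (2 ℕ.^ i) (2 ℕ.^ n))))
                      (sym (pow-assocʳ x (2 ℕ.^ n) (2 ℕ.^ i)))

  monic-replicate-0# : ∀ n x → monic (replicate n 0#) x ≈ pow K x n
  monic-replicate-0# zero    x = refl
  monic-replicate-0# (suc n) x = trans (+-identityˡ _) (*-congˡ (monic-replicate-0# n x))

module _ {c ℓ : Level} (K : FiniteField c ℓ) (e′ : ℕ) where
  open FiniteField K
  open Paper K (suc e′)

  module PolarDecomposition (k : ℕ) (q≡1+3k : q ≡ suc (3 ℕ.* k)) (1+1≈0 : 1# + 1# ≈ 0#)
                            (|K|≡q² : length elems ≡ q²) where

    open FieldFacts K
    open Characteristic2 1+1≈0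
    open Arithmetic
    open CubeExponents q k q≡1+3k
    open import Relation.Binary.Reasoning.Setoid setoid
    open import Algebra.Solver.Ring.NaturalCoefficients.Default commutativeSemiring
    open UniqueLists setoid
    open Membership setoid using (_∈_)
    open Subset setoid using (_⊆_)
    open Permutation setoid using (_↭_)
    open PermutationP setoid using (xs↭ys⇒|xs|≡|ys|)
    open UniqueS setoid using (Unique)
    open SetoidProperties setoid using (≉-resp₂)

    pow-q² : ∀ x → pow K x (q ℕ.* q) ≈ x
    pow-q² x = ≡.subst (λ n → pow K x n ≈ x) |K|≡q² (pow-|elems| x)

    pow-q+1 : ∀ x → pow K x (q ℕ.+ 1) ≈ pow K x q * x
    pow-q+1 x = trans (pow-homo-* x q 1) (*-congˡ (*-identityʳ x))

    inFq-resp : ∀ {x y} → x ≈ y → inFq x → inFq y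
    inFq-resp x≈y xᵠ≈x = trans (pow-congˡ q (sym x≈y)) (trans xᵠ≈x x≈y)

    inμ-resp : ∀ {x y} → x ≈ y → inμ x → inμ y
    inμ-resp x≈y x^[q+1]≈1 = trans (pow-congˡ (q ℕ.+ 1) (sym x≈y)) x^[q+1]≈1

    inFq⇒∈Fq : ∀ {y} → inFq y → y ∈ Fq
    inFq⇒∈Fq = MembershipP.∈-filter⁺ setoid (λ y → pow K y q ≟ y) inFq-resp (complete _)

    ∈Fq⇒inFq : ∀ {y} → y ∈ Fq → inFq y
    ∈Fq⇒inFq y∈ = proj₂ (MembershipP.∈-filter⁻ setoid (λ y → pow K y q ≟ y) inFq-resp {xs = elems} y∈)

    inμ⇒∈μ : ∀ {z} → inμ z → z ∈ μ
    inμ⇒∈μ = MembershipP.∈-filter⁺ setoid (λ z → pow K z (q ℕ.+ 1) ≟ 1#) inμ-resp (complete _)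

    ∈μ⇒inμ : ∀ {z} → z ∈ μ → inμ z
    ∈μ⇒inμ z∈ = proj₂ (MembershipP.∈-filter⁻ setoid (λ z → pow K z (q ℕ.+ 1) ≟ 1#) inμ-resp {xs = elems} z∈)

    2≤q : 2 ≤ q
    2≤q = ℕP.^-monoʳ-≤ 2 {1} {suc e′} (s≤s z≤n)

    0ᵠ≈0 : pow K 0# q ≈ 0#
    0ᵠ≈0 rewrite q≡1+3k = pow-0# (3 ℕ.* k)

    inμ⇒zᵠ≈z⁻¹ : ∀ {z} → inμ z → pow K z q ≈ z ⁻¹
    inμ⇒zᵠ≈z⁻¹ {z} zᵠ⁺¹≈1 = x*y≈1⇒y≈x⁻¹ (trans (*-comm z _) (trans (sym (pow-q+1 z)) zᵠ⁺¹≈1))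

    inμ⇒[z⁻¹]ᵠ≈z : ∀ {z} → inμ z → pow K (z ⁻¹) q ≈ z
    inμ⇒[z⁻¹]ᵠ≈z {z} zᵠ⁺¹≈1 = begin
      pow K (z ⁻¹) q         ≈⟨ pow-congˡ q (inμ⇒zᵠ≈z⁻¹ zᵠ⁺¹≈1) ⟨
      pow K (pow K z q) q    ≈⟨ pow-assocʳ z q q ⟩
      pow K z (q ℕ.* q)      ≈⟨ pow-q² z ⟩
      z                      ∎

    inμ-pow : ∀ {z} n → inμ z → inμ (pow K z n)
    inμ-pow {z} n zᵠ⁺¹≈1 = trans (pow-comm z n (q ℕ.+ 1)) (trans (pow-congˡ n zᵠ⁺¹≈1) (pow-1# n))

    inμ⇒[z^[1+k]]³≈z : ∀ {z} → inμ z → pow K (pow K z (suc k)) 3 ≈ z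
    inμ⇒[z^[1+k]]³≈z {z} zᵠ⁺¹≈1 = begin
      pow K (pow K z (suc k)) 3          ≈⟨ pow-comm z (suc k) 3 ⟩
      pow K (pow K z 3) (suc k)          ≈⟨ pow-assocʳ z 3 (suc k) ⟩
      pow K z (3 ℕ.* suc k)              ≈⟨ pow-congʳ z 3[1+k]≡q+2 ⟩
      pow K z ((q ℕ.+ 1) ℕ.+ 1)          ≈⟨ pow-homo-* z (q ℕ.+ 1) 1 ⟩
      pow K z (q ℕ.+ 1) * pow K z 1      ≈⟨ *-cong zᵠ⁺¹≈1 (*-identityʳ z) ⟩
      1# * z                             ≈⟨ *-identityˡ z ⟩
      z                                  ∎

    inμ⇒[z³]ᵈ≈z : ∀ {z} → inμ z → pow K (pow K z 3) d ≈ z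
    inμ⇒[z³]ᵈ≈z {z} zᵠ⁺¹≈1 = begin
      pow K (pow K z 3) d                   ≈⟨ pow-assocʳ z 3 d ⟩
      pow K z (3 ℕ.* d)                     ≈⟨ pow-congʳ z 3d≡q²+q+1 ⟩
      pow K z (q ℕ.* q ℕ.+ (q ℕ.+ 1))       ≈⟨ pow-homo-* z (q ℕ.* q) (q ℕ.+ 1) ⟩
      pow K z (q ℕ.* q) * pow K z (q ℕ.+ 1) ≈⟨ *-cong (pow-q² z) zᵠ⁺¹≈1 ⟩
      z * 1#                                ≈⟨ *-identityʳ z ⟩
      z                                     ∎

    inFq⇒yᵈ≈y : ∀ {y} → inFq y → pow K y d ≈ y
    inFq⇒yᵈ≈y {y} yᵠ≈y rewrite d≡1+[1+k]*3k = y^[1+j*3k]≈y (suc k)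
      where
      y^[1+j*3k]≈y : ∀ j → pow K y (suc (j ℕ.* (3 ℕ.* k))) ≈ y
      y^[1+j*3k]≈y zero    = *-identityʳ y
      y^[1+j*3k]≈y (suc j) = begin
        pow K y (suc (3 ℕ.* k ℕ.+ j ℕ.* (3 ℕ.* k)))  ≈⟨ pow-congʳ y (≡.cong (ℕ._+ j ℕ.* (3 ℕ.* k)) (≡.sym q≡1+3k)) ⟩
        pow K y (q ℕ.+ j ℕ.* (3 ℕ.* k))              ≈⟨ pow-homo-* y q _ ⟩
        pow K y q * pow K y (j ℕ.* (3 ℕ.* k))        ≈⟨ *-congʳ yᵠ≈y ⟩
        pow K y (suc (j ℕ.* (3 ℕ.* k)))              ≈⟨ y^[1+j*3k]≈y j ⟩
        y                                            ∎

    frobenius-q : ∀ x y → pow K (x + y) q ≈ pow K x q + pow K y q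
    frobenius-q = frobenius (suc e′)

    inFq⇒[y*x]ᵠ≈y*xᵠ : ∀ {y} x → inFq y → pow K (y * x) q ≈ y * pow K x q
    inFq⇒[y*x]ᵠ≈y*xᵠ {y} x yᵠ≈y = trans (pow-distrib-* y x q) (*-congʳ yᵠ≈y)

    σ-cong : ∀ {x y} → x ≈ y → σ x ≈ σ y
    σ-cong x≈y = +-cong (+-cong x≈y (pow-congˡ d x≈y)) (pow-congˡ (d ℕ.* q) x≈y)

    σ-polar : ∀ {y z} → inFq y → inμ z → σ (y * pow K z 3) ≈ y * pow K z 3 + y * z + y * z ⁻¹
    σ-polar {y} {z} yᵠ≈y zᵠ⁺¹≈1 = +-cong (+-congˡ uᵈ≈y*z) (begin
      pow K u (d ℕ.* q)   ≈⟨ pow-assocʳ u d q ⟨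
      pow K (pow K u d) q ≈⟨ pow-congˡ q uᵈ≈y*z ⟩
      pow K (y * z) q     ≈⟨ inFq⇒[y*x]ᵠ≈y*xᵠ z yᵠ≈y ⟩
      y * pow K z q       ≈⟨ *-congˡ (inμ⇒zᵠ≈z⁻¹ zᵠ⁺¹≈1) ⟩
      y * z ⁻¹            ∎)
      where
      u = y * pow K z 3
      uᵈ≈y*z : pow K u d ≈ y * z
      uᵈ≈y*z = trans (pow-distrib-* y (pow K z 3) d) (*-cong (inFq⇒yᵈ≈y yᵠ≈y) (inμ⇒[z³]ᵈ≈z zᵠ⁺¹≈1))

    Tr-q²≈Tr-q[x+xᵠ] : ∀ x → Tr-q² x ≈ Tr-q (x + pow K x q)
    Tr-q²≈Tr-q[x+xᵠ] x = begin
      Tr K (suc e′ ℕ.+ (suc e′ ℕ.+ 0)) x ≈⟨ Tr-split (suc e′) (suc e′ ℕ.+ 0) x ⟩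
      Tr K (suc e′) (pow K x (2 ℕ.^ (suc e′ ℕ.+ 0))) + Tr K (suc e′ ℕ.+ 0) x
        ≡⟨ ≡.cong (λ n → Tr K (suc e′) (pow K x (2 ℕ.^ n)) + Tr K n x) (ℕP.+-identityʳ (suc e′)) ⟩
      Tr-q (pow K x q) + Tr-q x          ≈⟨ +-comm _ _ ⟩
      Tr-q x + Tr-q (pow K x q)          ≈⟨ Tr-+ (suc e′) x (pow K x q) ⟨
      Tr-q (x + pow K x q)               ∎

    module _ {y z : Carrier} (yᵠ≈y : inFq y) (zᵠ⁺¹≈1 : inμ z) where

      [y*z³]ᵠ≈y*[z⁻¹]³ : pow K (y * pow K z 3) q ≈ y * pow K (z ⁻¹) 3
      [y*z³]ᵠ≈y*[z⁻¹]³ = trans (inFq⇒[y*x]ᵠ≈y*xᵠ (pow K z 3) yᵠ≈y)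
        (*-congˡ (trans (pow-comm z 3 q) (pow-congˡ 3 (inμ⇒zᵠ≈z⁻¹ zᵠ⁺¹≈1))))

      cubic-term : ∀ {α} → inFq α →
        α * pow K (y * pow K z 3) 3 + pow K (α * pow K (y * pow K z 3) 3) q ≈ P α z * pow K y 3
      cubic-term {α} αᵠ≈α = begin
        α * pow K (y * pow K z 3) 3 + pow K (α * pow K (y * pow K z 3) 3) q
          ≈⟨ +-congˡ (trans (inFq⇒[y*x]ᵠ≈y*xᵠ _ αᵠ≈α)
                            (*-congˡ (trans (pow-comm (y * pow K z 3) 3 q) (pow-congˡ 3 [y*z³]ᵠ≈y*[z⁻¹]³)))) ⟩
        α * pow K (y * pow K z 3) 3 + α * pow K (y * pow K (z ⁻¹) 3) 3
          ≈⟨ solve 4 (λ α y z w → α :* (y :* z :^ 3) :^ 3 :+ α :* (y :* w :^ 3) :^ 3 := α :* (z :^ 9 :+ w :^ 9) :* y :^ 3)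
                   refl α y z (z ⁻¹) ⟩
        P α z * pow K y 3 ∎

      linear-term : ∀ β → β * σ (y * pow K z 3) + pow K (β * σ (y * pow K z 3)) q ≈ Q β z * y
      linear-term β = begin
        β * σ (y * pow K z 3) + pow K (β * σ (y * pow K z 3)) q
          ≈⟨ +-congˡ (trans (pow-distrib-* β _ q) (*-congˡ (pow-congˡ q (σ-polar yᵠ≈y zᵠ⁺¹≈1)))) ⟩
        β * σ (y * pow K z 3) + bar β * pow K (y * pow K z 3 + y * z + y * z ⁻¹) q
          ≈⟨ +-cong (*-congˡ (σ-polar yᵠ≈y zᵠ⁺¹≈1)) (*-congˡ σ-conj) ⟩
        β * (y * pow K z 3 + y * z + y * z ⁻¹) + bar β * (y * pow K (z ⁻¹) 3 + y * z ⁻¹ + y * z)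
          ≈⟨ solve 5 (λ β β̄ y z w → β :* (y :* z :^ 3 :+ y :* z :+ y :* w) :+ β̄ :* (y :* w :^ 3 :+ y :* w :+ y :* z)
                                     := (β :* z :^ 3 :+ β̄ :* w :^ 3 :+ (β :+ β̄) :* (z :+ w)) :* y)
                   refl β (bar β) y z (z ⁻¹) ⟩
        Q β z * y ∎
        where
        σ-conj : pow K (y * pow K z 3 + y * z + y * z ⁻¹) q ≈ y * pow K (z ⁻¹) 3 + y * z ⁻¹ + y * z
        σ-conj = begin
          pow K (y * pow K z 3 + y * z + y * z ⁻¹) q
            ≈⟨ trans (frobenius-q _ _) (+-congʳ (frobenius-q _ _)) ⟩
          pow K (y * pow K z 3) q + pow K (y * z) q + pow K (y * z ⁻¹) q
            ≈⟨ +-cong (+-cong [y*z³]ᵠ≈y*[z⁻¹]³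
                              (trans (inFq⇒[y*x]ᵠ≈y*xᵠ z yᵠ≈y) (*-congˡ (inμ⇒zᵠ≈z⁻¹ zᵠ⁺¹≈1))))
                      (trans (inFq⇒[y*x]ᵠ≈y*xᵠ (z ⁻¹) yᵠ≈y) (*-congˡ (inμ⇒[z⁻¹]ᵠ≈z zᵠ⁺¹≈1))) ⟩
          y * pow K (z ⁻¹) 3 + y * z ⁻¹ + y * z ∎

      trace-polar : ∀ {α} β → inFq α →
        Tr-q² (α * pow K (y * pow K z 3) 3) + Tr-q² (β * σ (y * pow K z 3))
          ≈ Tr-q (P α z * pow K y 3 + Q β z * y)
      trace-polar β αᵠ≈α = begin
        Tr-q² _ + Tr-q² _                   ≈⟨ +-cong (Tr-q²≈Tr-q[x+xᵠ] _) (Tr-q²≈Tr-q[x+xᵠ] _) ⟩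
        Tr-q (_ + _) + Tr-q (_ + _)         ≈⟨ Tr-+ (suc e′) _ _ ⟨
        Tr-q ((_ + _) + (_ + _))            ≈⟨ Tr-cong (suc e′) (+-cong (cubic-term αᵠ≈α) (linear-term β)) ⟩
        Tr-q (P _ z * pow K y 3 + Q β z * y) ∎

    polar : Carrier × Carrier → Carrier
    polar (y , z) = y * pow K z 3

    polar-cong : ∀ {p p′} → Pointwise _≈_ _≈_ p p′ → polar p ≈ polar p′
    polar-cong (y≈ , z≈) = *-cong y≈ (pow-congˡ 3 z≈)

    inFq-norm : ∀ x → inFq (pow K x (q ℕ.+ 1))
    inFq-norm x = begin
      pow K (pow K x (q ℕ.+ 1)) q      ≈⟨ pow-comm x (q ℕ.+ 1) q ⟩
      pow K (pow K x q) (q ℕ.+ 1)      ≈⟨ pow-q+1 (pow K x q) ⟩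
      pow K (pow K x q) q * pow K x q  ≈⟨ *-congʳ (trans (pow-assocʳ x q q) (pow-q² x)) ⟩
      x * pow K x q                    ≈⟨ *-comm x _ ⟩
      pow K x q * x                    ≈⟨ pow-q+1 x ⟨
      pow K x (q ℕ.+ 1)                ∎

    -- On F_q the norm is squaring, which in characteristic 2 is inverted by s ↦ s ^ (q² / 2).
    Fq-norm-surjective : ∀ {s} → inFq s → ∃[ y ] inFq y × pow K y (q ℕ.+ 1) ≈ s
    Fq-norm-surjective {s} sᵠ≈s = y , yᵠ≈y , (begin
      pow K y (q ℕ.+ 1)     ≈⟨ pow-q+1 y ⟩
      pow K y q * y         ≈⟨ *-congʳ yᵠ≈y ⟩
      y * y                 ≈⟨ *-congˡ (*-identityʳ y) ⟨
      pow K y 2             ≈⟨ pow-assocʳ s (h ℕ.* q) 2 ⟩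
      pow K s (h ℕ.* q ℕ.* 2) ≈⟨ pow-congʳ s [h*q]*2≡q*q ⟩
      pow K s (q ℕ.* q)     ≈⟨ pow-q² s ⟩
      s                     ∎)
      where
      h = 2 ℕ.^ e′
      y = pow K s (h ℕ.* q)
      yᵠ≈y : inFq y
      yᵠ≈y = trans (pow-comm s (h ℕ.* q) q) (pow-congˡ (h ℕ.* q) sᵠ≈s)
      [h*q]*2≡q*q : h ℕ.* q ℕ.* 2 ≡ q ℕ.* q
      [h*q]*2≡q*q = ≡.trans (ℕP.*-comm (h ℕ.* q) 2) (≡.sym (ℕP.*-assoc 2 h q))

    -- y has the norm of x, so w = x / y lies in μ, and w ^ (1 + k) is a cube root of w
    -- because 3 (1 + k) = q + 2.
    polar-surjective : ∀ {x} → ¬ x ≈ 0# → ∃[ y ] ∃[ z ] (inFq y × ¬ y ≈ 0#) × inμ z × x ≈ y * pow K z 3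
    polar-surjective {x} x≉0 with y , yᵠ≈y , yᵠ⁺¹≈xᵠ⁺¹ ← Fq-norm-surjective (inFq-norm x) =
      y , pow K w (suc k) , (yᵠ≈y , y≉0) , inμ-pow (suc k) wᵠ⁺¹≈1 , (begin
        x                             ≈⟨ x*x⁻¹*y≈y x y≉0 ⟨
        y * (y ⁻¹ * x)                ≈⟨ *-congˡ (*-comm (y ⁻¹) x) ⟩
        y * w                         ≈⟨ *-congˡ (inμ⇒[z^[1+k]]³≈z wᵠ⁺¹≈1) ⟨
        y * pow K (pow K w (suc k)) 3 ∎)
      where
      y≉0 : ¬ y ≈ 0#
      y≉0 y≈0 = pow≉0 (q ℕ.+ 1) x≉0
        (trans (sym yᵠ⁺¹≈xᵠ⁺¹) (trans (pow-congˡ (q ℕ.+ 1) y≈0) (trans (pow-q+1 0#) (zeroʳ _))))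
      w = x * y ⁻¹
      wᵠ⁺¹≈1 : inμ w
      wᵠ⁺¹≈1 = begin
        pow K (x * y ⁻¹) (q ℕ.+ 1)                     ≈⟨ pow-distrib-* x (y ⁻¹) (q ℕ.+ 1) ⟩
        pow K x (q ℕ.+ 1) * pow K (y ⁻¹) (q ℕ.+ 1)     ≈⟨ *-congʳ yᵠ⁺¹≈xᵠ⁺¹ ⟨
        pow K y (q ℕ.+ 1) * pow K (y ⁻¹) (q ℕ.+ 1)     ≈⟨ pow-distrib-* y (y ⁻¹) (q ℕ.+ 1) ⟨
        pow K (y * y ⁻¹) (q ℕ.+ 1)                     ≈⟨ pow-congˡ (q ℕ.+ 1) (inverseʳ y y≉0) ⟩
        pow K 1# (q ℕ.+ 1)                             ≈⟨ pow-1# (q ℕ.+ 1) ⟩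
        1#                                             ∎

    Fq* : List Carrier
    Fq* = filter (λ y → ¬? (y ≟ 0#)) Fq

    Fq↭0∷Fq* : Fq ↭ 0# ∷ Fq*
    Fq↭0∷Fq* = Unique∧∈⇒↭∷filter≉ _≟_ (UniqueP.filter⁺ setoid _ distinct) (inFq⇒∈Fq 0ᵠ≈0)

    Fq*-inFq : All inFq Fq*
    Fq*-inFq = AllP.filter⁺ (λ y → ¬? (y ≟ 0#)) (AllP.all-filter (λ y → pow K y q ≟ y) elems)

    inFq*⇒∈Fq* : ∀ {y} → inFq y → ¬ y ≈ 0# → y ∈ Fq*
    inFq*⇒∈Fq* yᵠ≈y = MembershipP.∈-filter⁺ setoid (λ y → ¬? (y ≟ 0#)) (proj₂ ≉-resp₂) (inFq⇒∈Fq yᵠ≈y)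

    Fq-unique : Unique Fq
    Fq-unique = UniqueP.filter⁺ setoid _ distinct

    μ-unique : Unique μ
    μ-unique = UniqueP.filter⁺ setoid _ distinct

    |Fq|≤q : length Fq ≤ q
    |Fq|≤q = ℕP.≤-trans
      (monic-roots-bound (0# ∷ 1# ∷ replicate (q ℕ.∸ 2) 0#) Fq-unique (All.tabulateₛ setoid (root ∘ ∈Fq⇒inFq)))
      (ℕP.≤-reflexive (≡.trans (≡.cong (2 ℕ.+_) (length-replicate (q ℕ.∸ 2))) (ℕP.m+[n∸m]≡n 2≤q)))
      where
      root : ∀ {y} → inFq y → monic (0# ∷ 1# ∷ replicate (q ℕ.∸ 2) 0#) y ≈ 0#
      root {y} yᵠ≈y = begin
        0# + y * (1# + y * monic (replicate (q ℕ.∸ 2) 0#) y)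
          ≈⟨ +-congˡ (*-congˡ (+-congˡ (*-congˡ (monic-replicate-0# (q ℕ.∸ 2) y)))) ⟩
        0# + y * (1# + y * pow K y (q ℕ.∸ 2))
          ≈⟨ solve 2 (λ y p → con 0 :+ y :* (con 1 :+ y :* p) := y :+ y :* (y :* p)) refl y (pow K y (q ℕ.∸ 2)) ⟩
        y + pow K y (2 ℕ.+ (q ℕ.∸ 2)) ≈⟨ +-congˡ (pow-congʳ y (ℕP.m+[n∸m]≡n 2≤q)) ⟩
        y + pow K y q                 ≈⟨ +-congˡ yᵠ≈y ⟩
        y + y                         ≈⟨ x+x≈0 y ⟩
        0#                            ∎

    |μ|≤1+q : length μ ≤ suc q
    |μ|≤1+q = ℕP.≤-trans
      (monic-roots-bound (1# ∷ replicate q 0#) μ-unique (All.tabulateₛ setoid (root ∘ ∈μ⇒inμ)))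
      (ℕP.≤-reflexive (≡.cong suc (length-replicate q)))
      where
      root : ∀ {z} → inμ z → monic (1# ∷ replicate q 0#) z ≈ 0#
      root {z} zᵠ⁺¹≈1 = begin
        1# + z * monic (replicate q 0#) z ≈⟨ +-congˡ (*-congˡ (monic-replicate-0# q z)) ⟩
        1# + pow K z (suc q)              ≈⟨ +-congˡ (pow-congʳ z (ℕP.+-comm 1 q)) ⟩
        1# + pow K z (q ℕ.+ 1)            ≈⟨ +-congˡ zᵠ⁺¹≈1 ⟩
        1# + 1#                           ≈⟨ 1+1≈0 ⟩
        0#                                ∎

    polar-image : List Carrier
    polar-image = 0# ∷ map polar (cartesianProduct Fq* μ)

    elems⊆polar-image : elems ⊆ polar-image
    elems⊆polar-image {x} _ with x ≟ 0#
    ... | yes x≈0 = here x≈0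
    ... | no  x≉0 with y , z , (yᵠ≈y , y≉0) , zᵠ⁺¹≈1 , x≈y*z³ ← polar-surjective x≉0 =
      there (MembershipP.∈-resp-≈ setoid (sym x≈y*z³)
        (MembershipP.∈-map⁺ (setoid ×ₛ setoid) setoid polar-cong
          (MembershipP.∈-cartesianProduct⁺ setoid setoid (inFq*⇒∈Fq* yᵠ≈y y≉0) (inμ⇒∈μ zᵠ⁺¹≈1))))

    |polar-image| : length polar-image ≡ suc (length Fq* ℕ.* length μ)
    |polar-image| = ≡.cong suc (≡.trans (length-map polar (cartesianProduct Fq* μ)) (length-cartesianProduct Fq* μ))

    |Fq|≡1+|Fq*| : length Fq ≡ suc (length Fq*)
    |Fq|≡1+|Fq*| = xs↭ys⇒|xs|≡|ys| Fq↭0∷Fq*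

    1+|Fq*|≤q : suc (length Fq*) ≤ q
    1+|Fq*|≤q = ≡.subst (_≤ q) |Fq|≡1+|Fq*| |Fq|≤q

    |μ|≡1+q : length μ ≡ suc q
    |μ|≡1+q = q²≤1+ab⇒b≡1+q 2≤q 1+|Fq*|≤q |μ|≤1+q
      (≡.subst₂ _≤_ |K|≡q² |polar-image| (Unique∧⊆⇒|xs|≤|ys| distinct elems⊆polar-image))

    elems↭polar-image : elems ↭ polar-image
    elems↭polar-image = Unique∧⊆∧|ys|≤|xs|⇒↭ distinct elems⊆polar-image
      (≡.subst₂ _≤_ (≡.sym |polar-image|) (≡.sym |K|≡q²) (1+ab≤q² 1+|Fq*|≤q |μ|≤1+q))

    σ-0# : σ 0# ≈ 0#
    σ-0# = begin
      0# + pow K 0# d + pow K 0# (d ℕ.* q)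
        ≈⟨ +-cong (+-congˡ 0ᵈ≈0) (trans (sym (pow-assocʳ 0# d q)) (trans (pow-congˡ q 0ᵈ≈0) 0ᵠ≈0)) ⟩
      0# + 0# + 0#                          ≈⟨ trans (+-identityʳ _) (+-identityʳ 0#) ⟩
      0#                                    ∎
      where
      0ᵈ≈0 : pow K 0# d ≈ 0#
      0ᵈ≈0 rewrite d≡1+[1+k]*3k = pow-0# (suc k ℕ.* (3 ℕ.* k))

    trace-polar-0# : ∀ α β → Tr-q² (α * pow K 0# 3) + Tr-q² (β * σ 0#) ≈ 0#
    trace-polar-0# α β = begin
      Tr-q² (α * pow K 0# 3) + Tr-q² (β * σ 0#) ≈⟨ +-cong (Tr-cong (2 ℕ.* suc e′) (trans (*-congˡ (pow-0# 2)) (zeroʳ α)))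
                                                          (Tr-cong (2 ℕ.* suc e′) (trans (*-congˡ σ-0#) (zeroʳ β))) ⟩
      Tr-q² 0# + Tr-q² 0#                       ≈⟨ +-cong (Tr-0# (2 ℕ.* suc e′)) (Tr-0# (2 ℕ.* suc e′)) ⟩
      0# + 0#                                   ≈⟨ +-identityʳ 0# ⟩
      0#                                        ∎

    trace-RHS-0# : ∀ α β z → Tr-q (P α z * pow K 0# 3 + Q β z * 0#) ≈ 0#
    trace-RHS-0# α β z = begin
      Tr-q (P α z * pow K 0# 3 + Q β z * 0#)
        ≈⟨ Tr-cong (suc e′) (+-cong (trans (*-congˡ (pow-0# 2)) (zeroʳ _)) (zeroʳ _)) ⟩
      Tr-q (0# + 0#)                         ≈⟨ Tr-cong (suc e′) (+-identityʳ 0#) ⟩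
      Tr-q 0#                                ≈⟨ Tr-0# (suc e′) ⟩
      0#                                     ∎

  module WalshSpectrum (k : ℕ) (q≡1+3k : q ≡ suc (3 ℕ.* k)) (1+1≈0 : 1# + 1# ≈ 0#)
                       (|K|≡q² : length elems ≡ q²) where

    open FieldFacts K
    open Characteristic2 1+1≈0
    open PolarDecomposition k q≡1+3k 1+1≈0 |K|≡q²
    open ≡.≡-Reasoning

    module _ {α : Carrier} (αᵠ≈α : inFq α) (β : Carrier) where

      σ-summand : Carrier → ℤ
      σ-summand u = sgn K (Tr-q² (α * pow K u 3) + Tr-q² (β * σ u))

      RHS-summand : Carrier → Carrier → ℤ
      RHS-summand y z = sgn K (Tr-q (P α z * pow K y 3 + Q β z * y))

      RHS-inner : Carrier → ℤ
      RHS-inner y = sumℤ (map (RHS-summand y) μ)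

      σ-summand-cong : ∀ {u v} → u ≈ v → σ-summand u ≡ σ-summand v
      σ-summand-cong u≈v = sgn-cong (+-cong (Tr-cong (2 ℕ.* suc e′) (*-congˡ (pow-congˡ 3 u≈v)))
                                                (Tr-cong (2 ℕ.* suc e′) (*-congˡ (σ-cong u≈v))))

      RHS-inner-cong : ∀ {y y′} → y ≈ y′ → RHS-inner y ≡ RHS-inner y′
      RHS-inner-cong y≈y′ = ≡.cong sumℤ (map-cong (λ z → sgn-cong (Tr-cong (suc e′)
        (+-cong (*-congˡ (pow-congˡ 3 y≈y′)) (*-congˡ y≈y′)))) μ)

      polar-sum : sumℤ (map σ-summand elems) ≡ ℤ.+ 1 ℤ.+ sumℤ (map RHS-inner Fq*)
      polar-sum = begin
        sumℤ (map σ-summand elems)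
          ≡⟨ sumℤ-map-↭ setoid σ-summand-cong elems↭polar-image ⟩
        σ-summand 0# ℤ.+ sumℤ (map σ-summand (map polar (cartesianProduct Fq* μ)))
          ≡⟨ ≡.cong₂ ℤ._+_ (sgn-≈0 (trace-polar-0# α β))
                           (≡.cong sumℤ (≡.sym (map-∘ (cartesianProduct Fq* μ)))) ⟩
        ℤ.+ 1 ℤ.+ sumℤ (map (σ-summand ∘ polar) (cartesianProduct Fq* μ))
          ≡⟨ ≡.cong (ℤ._+_ (ℤ.+ 1)) (sumℤ-cartesianProduct (λ y z → σ-summand (y * pow K z 3)) Fq* μ) ⟩
        ℤ.+ 1 ℤ.+ sumℤ (map (λ y → sumℤ (map (λ z → σ-summand (y * pow K z 3)) μ)) Fq*)
          ≡⟨ ≡.cong (λ xs → ℤ.+ 1 ℤ.+ sumℤ xs) (map-cong-local (All.map (λ yᵠ≈y →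
               ≡.cong sumℤ (map-cong-local (All.tabulateₛ setoid (λ z∈μ →
                 sgn-cong (trace-polar yᵠ≈y (∈μ⇒inμ z∈μ) β αᵠ≈α)))))
               Fq*-inFq)) ⟩
        ℤ.+ 1 ℤ.+ sumℤ (map RHS-inner Fq*) ∎

      walsh-sum : ∀ τ → (∀ x → σ (τ x) ≈ x) → W τ α β ≡ ℤ.+ 1 ℤ.+ sumℤ (map RHS-inner Fq*)
      walsh-sum τ σ∘τ≈id = begin
        sumℤ (map (λ x → sgn K (f τ α x + Tr-q² (β * x))) elems)
          ≡⟨ ≡.cong sumℤ (map-cong (λ x →
               sgn-cong (+-congˡ (Tr-cong (2 ℕ.* suc e′) (*-congˡ (sym (σ∘τ≈id x)))))) elems) ⟩
        sumℤ (map (σ-summand ∘ τ) elems)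
          ≡⟨ ≡.cong sumℤ (map-∘ elems) ⟩
        sumℤ (map σ-summand (map τ elems))
          ≡⟨ sumℤ-map-↭ setoid σ-summand-cong
               (UniqueLists.map-section-↭ setoid σ-cong σ∘τ≈id distinct complete) ⟩
        sumℤ (map σ-summand elems)
          ≡⟨ polar-sum ⟩
        ℤ.+ 1 ℤ.+ sumℤ (map RHS-inner Fq*) ∎

      RHS-sum : RHS α β ≡ ℤ.+ 1 ℤ.+ sumℤ (map RHS-inner Fq*)
      RHS-sum = begin
        sumℤ (map RHS-inner Fq) ℤ.- ℤ.+ q
          ≡⟨ ≡.cong (ℤ._- ℤ.+ q) (sumℤ-map-↭ setoid RHS-inner-cong Fq↭0∷Fq*) ⟩
        (RHS-inner 0# ℤ.+ sumℤ (map RHS-inner Fq*)) ℤ.- ℤ.+ q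
          ≡⟨ ≡.cong (λ t → (t ℤ.+ sumℤ (map RHS-inner Fq*)) ℤ.- ℤ.+ q)
               (≡.trans (sumℤ-map-1 (λ z → sgn-≈0 (trace-RHS-0# α β z)) μ) (≡.cong ℤ.+_ |μ|≡1+q)) ⟩
        (ℤ.+ suc q ℤ.+ sumℤ (map RHS-inner Fq*)) ℤ.- ℤ.+ q
          ≡⟨ Arithmetic.[1+n+x]-n≡1+x q (sumℤ (map RHS-inner Fq*)) ⟩
        ℤ.+ 1 ℤ.+ sumℤ (map RHS-inner Fq*) ∎

lemma2p1 : ∀ {c ℓ : Level} (K : FiniteField c ℓ) (e : ℕ) → 0 < e → e % 2 ≡ 0 →
    let open FiniteField K in
    let open Paper K e in
    (1# + 1#) ≈ 0# →
    length elems ≡ q² →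
    (τ : Carrier → Carrier) → (∀ x → σ (τ x) ≈ x) →
    (α β : Carrier) → pow K α q ≈ α → ¬ (α ≈ 0#) →
    W τ α β ≡ RHS α β
lemma2p1 K zero () _ _ _ _ _ _ _ _ _
lemma2p1 K (suc e′) _ e%2≡0 1+1≈0 |K|≡q² τ σ∘τ≈id α β αᵠ≈α _
  with k , q≡1+3k ← Arithmetic.2^even≡1+3k (suc e′) e%2≡0 =
  ≡.trans (walsh-sum αᵠ≈α β τ σ∘τ≈id) (≡.sym (RHS-sum αᵠ≈α β))
  where open WalshSpectrum K e′ k q≡1+3k 1+1≈0 |K|≡q²
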